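{- Let ${\cal A}_d\subset\mathbb{Z}^2$ be an optimal tristance anticode of diameter $d$ in the grid graph ${\cal G}_2$. Then $${\cal A}_d=\bigcap_{z_1,z_2\in{\cal A}_d}{\cal A}_d(z_1,z_2),$$ where ${\cal A}_d(z_1,z_2)=\{z\in\mathbb{Z}^2: d_3(z_1,z_2,z)\le d\}$.
   Context: The grid graph ${\cal G}_2$ has vertex set $\mathbb{Z}^2$, with $z,z'$ adjacent iff their $L_1$-distance is $1$. For $z_1,z_2,z_3\in\mathbb{Z}^2$, the tristance $d_3(z_1,z_2,z_3)$ is the minimum number of edges of a tree in ${\cal G}_2$ (possibly using additional vertices) containing $z_1,z_2,z_3$. A set ${\cal A}\subset\mathbb{Z}^2$ is a tristance anticode of diameter $d$ if $d_3(z_1,z_2,z_3)\le d$ for all $z_1,z_2,z_3\in{\cal A}$; it is optimal if it has largest possible cardinality among such sets. -}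

module Defs where

open import Data.Nat using (ℕ; suc; _≤_)
open import Data.Integer using (ℤ; +_; _+_)
open import Data.Bool using (Bool; true; false)
open import Data.Product using (_×_; _,_; ∃)
open import Data.Sum using (_⊎_)
open import Data.List using (List; length)
open import Data.List.Membership.Propositional using (_∈_)
open import Data.List.Relation.Unary.Unique.Propositional using (Unique)
open import Data.List.Relation.Unary.All using (All)
open import Relation.Binary.PropositionalEquality using (_≡_)

Point : Set
Point = ℤ × ℤ

-- An edge of G_2 is determined by its lower/left endpoint and a direction
-- (true = horizontal, joining (x,y)-(x+1,y); false = vertical, (x,y)-(x,y+1)).
-- This gives a bijection with the set of edges {z,z'} with ‖z - z'‖₁ = 1.
Edge : Set
Edge = Point × Bool

src : Edge → Point
src ((x , y) , _) = (x , y)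

tgt : Edge → Point
tgt ((x , y) , true)  = (x + + 1 , y)
tgt ((x , y) , false) = (x , y + + 1)

Joins : Edge → Point → Point → Set
Joins e u v = (src e ≡ u × tgt e ≡ v) ⊎ (src e ≡ v × tgt e ≡ u)

data Reach (E : List Edge) (u : Point) : Point → Set where
  here : Reach E u u
  step : ∀ {w v} (e : Edge) → e ∈ E → Joins e w v → Reach E u w → Reach E u v

record IsTree (V : List Point) (E : List Edge) : Set where
  field
    uniqueV   : Unique V
    uniqueE   : Unique E
    srcInV    : All (λ e → src e ∈ V) E
    tgtInV    : All (λ e → tgt e ∈ V) E
    root      : Point
    rootInV   : root ∈ V
    connected : All (Reach E root) V
    count     : length V ≡ suc (length E)

-- d₃(z₁,z₂,z₃) ≤ d : since d₃ is the minimum number of edges of a tree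
-- containing z₁,z₂,z₃, this holds iff some such tree has at most d edges.
Tristance≤ : ℕ → Point → Point → Point → Set
Tristance≤ d z₁ z₂ z₃ =
  ∃ λ (V : List Point) → ∃ λ (E : List Edge) →
    IsTree V E × z₁ ∈ V × z₂ ∈ V × z₃ ∈ V × length E ≤ d

-- Finite subsets of ℤ² are represented by duplicate-free lists.
-- (Any nonempty tristance anticode is bounded, hence finite.)
IsAnticode : ℕ → List Point → Set
IsAnticode d A = ∀ {z₁ z₂ z₃} → z₁ ∈ A → z₂ ∈ A → z₃ ∈ A → Tristance≤ d z₁ z₂ z₃

IsOptimalAnticode : ℕ → List Point → Set
IsOptimalAnticode d A =
  Unique A × IsAnticode d A ×
  (∀ (B : List Point) → Unique B → IsAnticode d B → length B ≤ length A)

InA : ℕ → Point → Point → Point → Set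
InA d z₁ z₂ z = Tristance≤ d z₁ z₂ z

-- An optimal anticode is maximal under inclusion: if some z ∉ A lay in every
-- A_d(z₁,z₂), then every triple of z ∷ A would have tristance at most d
-- (triples repeating z are covered because a tree containing z₁, z₂ and z
-- contains every triple drawn from them), so z ∷ A would be a larger anticode.
module Submission where

open import Defs
open import Data.Nat using (ℕ; z≤n)
open import Data.Nat.Properties using (1+n≰n)
open import Data.List using (List; []; _∷_)
open import Data.List.Membership.Propositional using (_∈_; _∉_)
open import Data.List.Relation.Unary.Any using (here; there)
open import Data.List.Relation.Unary.All using ([]; _∷_)
open import Data.List.Relation.Unary.All.Properties using (¬Any⇒All¬)
open import Data.List.Relation.Unary.AllPairs using ([]; _∷_)
open import Data.List.Relation.Unary.Unique.Propositional using (Unique)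
open import Data.Product using (_,_)
open import Data.Product.Properties using (≡-dec)
import Data.Integer.Properties as ℤ
open import Data.List.Membership.DecPropositional (≡-dec ℤ._≟_ ℤ._≟_) using (_∈?_)
open import Relation.Binary.PropositionalEquality using (refl)
open import Relation.Nullary using (yes; no; contradiction)
open import Function.Bundles using (_⇔_; mk⇔)

IsTree-singleton : ∀ z → IsTree (z ∷ []) []
IsTree-singleton z = record
  { uniqueV = [] ∷ [] ; uniqueE = [] ; srcInV = [] ; tgtInV = []
  ; root = z ; rootInV = here refl ; connected = Reach.here ∷ [] ; count = refl }

Tristance≤-refl : ∀ d z → Tristance≤ d z z z
Tristance≤-refl d z =
  z ∷ [] , [] , IsTree-singleton z , here refl , here refl , here refl , z≤n

pattern 1st = here refl
pattern 2nd = there (here refl)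
pattern 3rd = there (there (here refl))

Tristance≤-among : ∀ {d a b c x y w} →
  x ∈ a ∷ b ∷ c ∷ [] → y ∈ a ∷ b ∷ c ∷ [] → w ∈ a ∷ b ∷ c ∷ [] →
  Tristance≤ d a b c → Tristance≤ d x y w
Tristance≤-among {a = a} {b} {c} x∈ y∈ w∈ (V , E , tree , a∈V , b∈V , c∈V , size) =
  V , E , tree , inV x∈ , inV y∈ , inV w∈ , size
  where
  inV : ∀ {p} → p ∈ a ∷ b ∷ c ∷ [] → p ∈ V
  inV 1st = a∈V
  inV 2nd = b∈V
  inV 3rd = c∈V

IsAnticode-∷ : ∀ {d A z} → IsAnticode d A →
  (∀ {z₁ z₂} → z₁ ∈ A → z₂ ∈ A → InA d z₁ z₂ z) → IsAnticode d (z ∷ A)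
IsAnticode-∷ {d} {z = z} _ _ (here refl) (here refl) (here refl) = Tristance≤-refl d z
IsAnticode-∷ _ near (here refl) (here refl) (there c) = Tristance≤-among 3rd 3rd 1st (near c c)
IsAnticode-∷ _ near (here refl) (there b) (here refl) = Tristance≤-among 3rd 1st 3rd (near b b)
IsAnticode-∷ _ near (there a) (here refl) (here refl) = Tristance≤-among 1st 3rd 3rd (near a a)
IsAnticode-∷ _ near (here refl) (there b) (there c)   = Tristance≤-among 3rd 1st 2nd (near b c)
IsAnticode-∷ _ near (there a) (here refl) (there c)   = Tristance≤-among 1st 3rd 2nd (near a c)
IsAnticode-∷ _ near (there a) (there b) (here refl)   = near a b
IsAnticode-∷ acA _  (there a) (there b) (there c)     = acA a b c

Unique-∷ : ∀ {a} {X : Set a} {x : X} {xs} → x ∉ xs → Unique xs → Unique (x ∷ xs)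
Unique-∷ x∉xs u = ¬Any⇒All¬ _ x∉xs ∷ u

lemma10 : (d : ℕ) (A : List Point) → IsOptimalAnticode d A →
    ∀ (z : Point) → (z ∈ A) ⇔ (∀ {z₁ z₂} → z₁ ∈ A → z₂ ∈ A → InA d z₁ z₂ z)
lemma10 d A (uA , acA , optimal) z = mk⇔ inPairs maximal
  where
  inPairs : z ∈ A → ∀ {z₁ z₂} → z₁ ∈ A → z₂ ∈ A → InA d z₁ z₂ z
  inPairs z∈A z₁∈A z₂∈A = acA z₁∈A z₂∈A z∈A

  maximal : (∀ {z₁ z₂} → z₁ ∈ A → z₂ ∈ A → InA d z₁ z₂ z) → z ∈ A
  maximal near with z ∈? A
  ... | yes z∈A = z∈A
  ... | no  z∉A = contradiction
    (optimal (z ∷ A) (Unique-∷ z∉A uA) (IsAnticode-∷ acA near)) 1+n≰n
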